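{- The logic L is a conservative extension of classical propositional logic CPC: for every $\varphi\in Fm_0$, $\varphi$ is a theorem of CPC if and only if $\vdash_L\varphi$.
   Context: Let $V=\{x_0,x_1,\dots\}$ be an infinite set of propositional variables; $Fm$ is generated from $V$ by $\bot$, binary $\rightarrow,\vee,\wedge$ and unary $\square$; $Fm_0\subseteq Fm$ is the set of formulas without $\square$. Abbreviations: $\neg\varphi:=\varphi\rightarrow\bot$, $\varphi\equiv\psi:=\square(\varphi\rightarrow\psi)\wedge\square(\psi\rightarrow\varphi)$; $\chi[x:=\varphi]$ is substitution of $\varphi$ for $x$ in $\chi$. The logic L: axioms are all formulas of the forms (i) substitution instances (variables replaced by arbitrary formulas of $Fm$) of intuitionistic propositional tautologies; (ii) $\square\varphi\rightarrow\varphi$; (iii) $\square(\varphi\rightarrow\psi)\rightarrow(\square(\psi\rightarrow\chi)\rightarrow\square(\varphi\rightarrow\chi))$; (iv) $\square(\varphi\vee\psi)\rightarrow(\square\varphi\vee\square\psi)$; rules are Modus Ponens and Axiom Necessitation (from an axiom $\varphi$ of form (i)–(iv) infer $\square\varphi$); additionally all formulas $\varphi\vee\neg\varphi$ and $(\varphi\equiv\psi)\rightarrow(\chi[x:=\varphi]\equiv\chi[x:=\psi])$ are theorems (usable in derivations, not subject to Axiom Necessitation). $\vdash_L\varphi$ means $\varphi$ is derivable in L without assumptions. -}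

module Defs where

open import Data.Nat using (ℕ; _≡ᵇ_)
open import Data.Bool using (Bool; true; false; if_then_else_)
open import Data.Product using (Σ; _×_; ∃)
open import Relation.Binary.PropositionalEquality using (_≡_)

infixr 5 _⇒_
infixr 6 _∨_
infixr 7 _∧_

data Fm : Set where
  var : ℕ → Fm
  ⊥   : Fm
  _⇒_ : Fm → Fm → Fm
  _∨_ : Fm → Fm → Fm
  _∧_ : Fm → Fm → Fm
  □_  : Fm → Fm

¬_ : Fm → Fm
¬ φ = φ ⇒ ⊥

_≣_ : Fm → Fm → Fm
φ ≣ ψ = (□ (φ ⇒ ψ)) ∧ (□ (ψ ⇒ φ))

_[_≔_] : Fm → ℕ → Fm → Fm
var y   [ x ≔ φ ] = if y ≡ᵇ x then φ else var y
⊥       [ x ≔ φ ] = ⊥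
(a ⇒ b) [ x ≔ φ ] = (a [ x ≔ φ ]) ⇒ (b [ x ≔ φ ])
(a ∨ b) [ x ≔ φ ] = (a [ x ≔ φ ]) ∨ (b [ x ≔ φ ])
(a ∧ b) [ x ≔ φ ] = (a [ x ≔ φ ]) ∧ (b [ x ≔ φ ])
(□ a)   [ x ≔ φ ] = □ (a [ x ≔ φ ])

data Fm₀ : Set where
  var : ℕ → Fm₀
  ⊥   : Fm₀
  _⇒_ : Fm₀ → Fm₀ → Fm₀
  _∨_ : Fm₀ → Fm₀ → Fm₀
  _∧_ : Fm₀ → Fm₀ → Fm₀

¬₀_ : Fm₀ → Fm₀
¬₀ φ = φ ⇒ ⊥

inst : (ℕ → Fm) → Fm₀ → Fm
inst σ (var x) = σ x
inst σ ⊥       = ⊥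
inst σ (a ⇒ b) = inst σ a ⇒ inst σ b
inst σ (a ∨ b) = inst σ a ∨ inst σ b
inst σ (a ∧ b) = inst σ a ∧ inst σ b

ι : Fm₀ → Fm
ι = inst var

-- Hilbert calculus for intuitionistic (cl = false) and classical (cl = true)
-- propositional logic on □-free formulas. CPC = IPC + excluded middle.

data Hilbert (cl : Bool) : Fm₀ → Set where
  K    : ∀ {φ ψ} → Hilbert cl (φ ⇒ (ψ ⇒ φ))
  S    : ∀ {φ ψ χ} → Hilbert cl ((φ ⇒ (ψ ⇒ χ)) ⇒ ((φ ⇒ ψ) ⇒ (φ ⇒ χ)))
  ∧E₁  : ∀ {φ ψ} → Hilbert cl ((φ ∧ ψ) ⇒ φ)
  ∧E₂  : ∀ {φ ψ} → Hilbert cl ((φ ∧ ψ) ⇒ ψ)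
  ∧I   : ∀ {φ ψ} → Hilbert cl (φ ⇒ (ψ ⇒ (φ ∧ ψ)))
  ∨I₁  : ∀ {φ ψ} → Hilbert cl (φ ⇒ (φ ∨ ψ))
  ∨I₂  : ∀ {φ ψ} → Hilbert cl (ψ ⇒ (φ ∨ ψ))
  ∨E   : ∀ {φ ψ χ} → Hilbert cl ((φ ⇒ χ) ⇒ ((ψ ⇒ χ) ⇒ ((φ ∨ ψ) ⇒ χ)))
  efq  : ∀ {φ} → Hilbert cl (⊥ ⇒ φ)
  lem  : ∀ {φ} → cl ≡ true → Hilbert cl (φ ∨ (¬₀ φ))
  mp   : ∀ {φ ψ} → Hilbert cl (φ ⇒ ψ) → Hilbert cl φ → Hilbert cl ψ

IPC : Fm₀ → Set
IPC = Hilbert false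

CPC : Fm₀ → Set
CPC = Hilbert true

data Axiom : Fm → Set where
  ipc  : ∀ {ψ} (σ : ℕ → Fm) → IPC ψ → Axiom (inst σ ψ)
  refl□ : ∀ {φ} → Axiom ((□ φ) ⇒ φ)
  trans□ : ∀ {φ ψ χ} → Axiom ((□ (φ ⇒ ψ)) ⇒ ((□ (ψ ⇒ χ)) ⇒ (□ (φ ⇒ χ))))
  disj□ : ∀ {φ ψ} → Axiom ((□ (φ ∨ ψ)) ⇒ ((□ φ) ∨ (□ ψ)))

data ⊢L : Fm → Set where
  ax   : ∀ {φ} → Axiom φ → ⊢L φ
  nec  : ∀ {φ} → Axiom φ → ⊢L (□ φ)
  mp   : ∀ {φ ψ} → ⊢L (φ ⇒ ψ) → ⊢L φ → ⊢L ψ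
  lem  : ∀ {φ} → ⊢L (φ ∨ (¬ φ))
  sub≣ : ∀ {φ ψ} (χ : Fm) (x : ℕ) →
         ⊢L ((φ ≣ ψ) ⇒ ((χ [ x ≔ φ ]) ≣ (χ [ x ≔ ψ ])))

module Submission where

-- (⇒) Every axiom of CPC is either an axiom of IPC, hence an instance
--     (under the identity substitution `var`) of an axiom (i) of L, or an
--     excluded-middle formula, which is a theorem of L; modus ponens is a
--     rule of both systems.  So CPC φ gives ⊢L (ι φ).
-- (⇐) Erasing all boxes maps every theorem of L to a theorem of CPC:
--     axioms (i) become substitution instances of IPC theorems, (ii) and
--     (iv) become φ → φ, (iii) becomes transitivity of implication, and the
--     replacement theorem (φ ≣ ψ) → (χ[x≔φ] ≣ χ[x≔ψ]) becomes the classical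
--     replacement of provably equivalent formulas.  Erasure fixes □-free
--     formulas, so ⊢L (ι φ) gives CPC φ.

open import Defs
open import Function.Bundles using (_⇔_; mk⇔)
open import Data.Nat using (ℕ; _≡ᵇ_)
open import Data.Bool using (Bool; true; false)
open import Data.List using (List; []; _∷_)
open import Data.List.Membership.Propositional using (_∈_)
open import Data.List.Relation.Unary.Any using (here; there)
open import Data.Product using (_×_; _,_)
open import Relation.Binary.PropositionalEquality using (_≡_; refl; subst; cong₂)

erase : Fm → Fm₀
erase (var x) = var x
erase ⊥       = ⊥
erase (a ⇒ b) = erase a ⇒ erase b
erase (a ∨ b) = erase a ∨ erase b
erase (a ∧ b) = erase a ∧ erase b
erase (□ a)   = erase a

erase-ι : (φ : Fm₀) → erase (ι φ) ≡ φ
erase-ι (var x) = refl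
erase-ι ⊥       = refl
erase-ι (a ⇒ b) = cong₂ _⇒_ (erase-ι a) (erase-ι b)
erase-ι (a ∨ b) = cong₂ _∨_ (erase-ι a) (erase-ι b)
erase-ι (a ∧ b) = cong₂ _∧_ (erase-ι a) (erase-ι b)

-- The erasure of any substitution instance of an IPC- or CPC-theorem is a
-- CPC-theorem: the Hilbert axioms are schemata, so the derivation can be
-- replayed on the erased instance.
erase-instance : ∀ {cl ψ} (σ : ℕ → Fm) → Hilbert cl ψ → CPC (erase (inst σ ψ))
erase-instance σ K        = K
erase-instance σ S        = S
erase-instance σ ∧E₁      = ∧E₁
erase-instance σ ∧E₂      = ∧E₂
erase-instance σ ∧I       = ∧I
erase-instance σ ∨I₁      = ∨I₁
erase-instance σ ∨I₂      = ∨I₂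
erase-instance σ ∨E       = ∨E
erase-instance σ efq      = efq
erase-instance σ (lem _)  = lem refl
erase-instance σ (mp d e) = mp (erase-instance σ d) (erase-instance σ e)

-- Derivations from a list of hypotheses Γ, over the calculus Hilbert cl.
-- They serve only to build closed derivations conveniently via the
-- deduction theorem below.
module Deduction (cl : Bool) where

  infix 3 _⊢_

  data _⊢_ (Γ : List Fm₀) : Fm₀ → Set where
    hyp : ∀ {φ} → φ ∈ Γ → Γ ⊢ φ
    thm : ∀ {φ} → Hilbert cl φ → Γ ⊢ φ
    app : ∀ {φ ψ} → Γ ⊢ φ ⇒ ψ → Γ ⊢ φ → Γ ⊢ ψ

  hyp₀ : ∀ {Γ φ} → φ ∷ Γ ⊢ φ
  hyp₀ = hyp (here refl)

  hyp₁ : ∀ {Γ φ ψ} → ψ ∷ φ ∷ Γ ⊢ φ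
  hyp₁ = hyp (there (here refl))

  identity : ∀ {φ} → Hilbert cl (φ ⇒ φ)
  identity {φ} = mp (mp S K) (K {ψ = φ})

  weaken : ∀ {Γ φ ψ} → Γ ⊢ φ → ψ ∷ Γ ⊢ φ
  weaken (hyp p)   = hyp (there p)
  weaken (thm d)   = thm d
  weaken (app d e) = app (weaken d) (weaken e)

  discharge : ∀ {Γ φ ψ} → φ ∷ Γ ⊢ ψ → Γ ⊢ φ ⇒ ψ
  discharge (hyp (here refl)) = thm identity
  discharge (hyp (there p))   = app (thm K) (hyp p)
  discharge (thm d)           = app (thm K) (thm d)
  discharge (app d e)         = app (app (thm S) (discharge d)) (discharge e)

  closed : ∀ {φ} → [] ⊢ φ → Hilbert cl φ
  closed (hyp ())
  closed (thm d)   = d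
  closed (app d e) = mp (closed d) (closed e)

  mono⇒ : ∀ {Γ a a′ b b′} → Γ ⊢ a′ ⇒ a → Γ ⊢ b ⇒ b′ → Γ ⊢ (a ⇒ b) ⇒ (a′ ⇒ b′)
  mono⇒ a′a bb′ =
    discharge (discharge (app (weaken (weaken bb′)) (app hyp₁ (app (weaken (weaken a′a)) hyp₀))))

  mono∨ : ∀ {Γ a a′ b b′} → Γ ⊢ a ⇒ a′ → Γ ⊢ b ⇒ b′ → Γ ⊢ (a ∨ b) ⇒ (a′ ∨ b′)
  mono∨ aa′ bb′ =
    app (app (thm ∨E) (discharge (app (thm ∨I₁) (app (weaken aa′) hyp₀))))
                      (discharge (app (thm ∨I₂) (app (weaken bb′) hyp₀)))

  mono∧ : ∀ {Γ a a′ b b′} → Γ ⊢ a ⇒ a′ → Γ ⊢ b ⇒ b′ → Γ ⊢ (a ∧ b) ⇒ (a′ ∧ b′)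
  mono∧ aa′ bb′ =
    discharge (app (app (thm ∧I) (app (weaken aa′) (app (thm ∧E₁) hyp₀)))
                                 (app (weaken bb′) (app (thm ∧E₂) hyp₀)))

  _⊢_↔_ : List Fm₀ → Fm₀ → Fm₀ → Set
  Γ ⊢ a ↔ b = (Γ ⊢ a ⇒ b) × (Γ ⊢ b ⇒ a)

  replacement : ∀ {Γ φ ψ} (χ : Fm) (x : ℕ) → Γ ⊢ erase φ ↔ erase ψ →
                Γ ⊢ erase (χ [ x ≔ φ ]) ↔ erase (χ [ x ≔ ψ ])
  replacement (var y) x φ↔ψ with y ≡ᵇ x
  ... | true  = φ↔ψ
  ... | false = thm identity , thm identity
  replacement ⊥       x φ↔ψ = thm identity , thm identity
  replacement (c ⇒ d) x φ↔ψ with replacement c x φ↔ψ | replacement d x φ↔ψ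
  ... | c→ , c← | d→ , d← = mono⇒ c← d→ , mono⇒ c→ d←
  replacement (c ∨ d) x φ↔ψ with replacement c x φ↔ψ | replacement d x φ↔ψ
  ... | c→ , c← | d→ , d← = mono∨ c→ d→ , mono∨ c← d←
  replacement (c ∧ d) x φ↔ψ with replacement c x φ↔ψ | replacement d x φ↔ψ
  ... | c→ , c← | d→ , d← = mono∧ c→ d→ , mono∧ c← d←
  replacement (□ c)   x φ↔ψ = replacement c x φ↔ψ

open Deduction true

erase-axiom : ∀ {φ} → Axiom φ → CPC (erase φ)
erase-axiom (ipc σ d) = erase-instance σ d
erase-axiom refl□     = identity
erase-axiom trans□    =
  closed (discharge (discharge (discharge (app hyp₁ (app (weaken (weaken hyp₀)) hyp₀)))))
erase-axiom disj□     = identity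

erase-replacement : ∀ {φ ψ} (χ : Fm) (x : ℕ) →
                    CPC (erase ((φ ≣ ψ) ⇒ ((χ [ x ≔ φ ]) ≣ (χ [ x ≔ ψ ]))))
erase-replacement χ x with replacement χ x (app (thm ∧E₁) hyp₀ , app (thm ∧E₂) hyp₀)
... | χφ→χψ , χψ→χφ = closed (discharge (app (app (thm ∧I) χφ→χψ) χψ→χφ))

erase-sound : ∀ {φ} → ⊢L φ → CPC (erase φ)
erase-sound (ax a)       = erase-axiom a
erase-sound (nec a)      = erase-axiom a
erase-sound (mp d e)     = mp (erase-sound d) (erase-sound e)
erase-sound lem          = lem refl
erase-sound (sub≣ χ x)   = erase-replacement χ x

embed : ∀ {φ} → CPC φ → ⊢L (ι φ)
embed {φ} K        = ax (ipc {φ} var K)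
embed {φ} S        = ax (ipc {φ} var S)
embed {φ} ∧E₁      = ax (ipc {φ} var ∧E₁)
embed {φ} ∧E₂      = ax (ipc {φ} var ∧E₂)
embed {φ} ∧I       = ax (ipc {φ} var ∧I)
embed {φ} ∨I₁      = ax (ipc {φ} var ∨I₁)
embed {φ} ∨I₂      = ax (ipc {φ} var ∨I₂)
embed {φ} ∨E       = ax (ipc {φ} var ∨E)
embed {φ} efq      = ax (ipc {φ} var efq)
embed     (lem _)  = lem
embed     (mp d e) = mp (embed d) (embed e)

corollary3p9 : (φ : Fm₀) → CPC φ ⇔ ⊢L (ι φ)
corollary3p9 φ = mk⇔ embed (λ ⊢φ → subst CPC (erase-ι φ) (erase-sound ⊢φ))
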